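{- Let $G=(V,E)$ be a graph with distinct vertex identifiers $\mathrm{ID}(v)$ and integer edge weights $w\colon E\to\{1,\dots,W\}$, let $p\in(0,1)$, $r\in\mathbb{N}$, and let $(\delta_v)_{v\in V}$ be any values in $\{0,1,\dots,r\}$ (e.g. sampled independently from $\mathrm{GeomCap}(p,r)$). Define for $u,x\in V$: $d^{(u)}(s,x):=r-\delta_u+d_G(u,x)$, the level $d'(x):=\min_{u\in V}d^{(u)}(s,x)$, and the cluster center $c_x$ as the vertex $u$ with minimal $\mathrm{ID}(u)$ among those with $d^{(u)}(s,x)=d'(x)$. For each center $v$, let its cluster be $\{x\in V: c_x=v\}$. Then each cluster contains its center and is spanned by a tree rooted at its center, consisting of edges of $G$ with both endpoints in the cluster, of height at most $r$.
   Context: $\mathrm{GeomCap}(p,r)$ is the distribution on $\{0,\dots,r\}$ with $\Pr[i]=p(1-p)^i$ for $0\le i\le r-1$ and $\Pr[r]=(1-p)^r$. $d_G$ denotes weighted shortest-path distance in $G$. The height of the tree is measured in weighted distance. -}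

module Defs where

open import Data.Nat using (ℕ; zero; suc; _+_; _∸_; _≤_)
open import Data.Fin using (Fin)
open import Data.Maybe using (Maybe; just; nothing)
open import Data.Product using (Σ; _×_; _,_; ∃-syntax)
open import Relation.Binary.PropositionalEquality using (_≡_)
open import Relation.Nullary using (¬_)
open import Function.Definitions using (Injective)

-- A finite undirected weighted graph on vertex set Fin n.
-- w u v ≡ just k  means {u,v} is an edge of weight k; nothing means no edge.
record WGraph (n W : ℕ) : Set where
  field
    w         : Fin n → Fin n → Maybe ℕ
    symmetric : ∀ u v → w u v ≡ w v u
    loopless  : ∀ u → w u u ≡ nothing
    weight-range : ∀ u v k → w u v ≡ just k → (1 ≤ k × k ≤ W)
open WGraph public

module _ {n W : ℕ} (G : WGraph n W) where

  data Walk : Fin n → Fin n → ℕ → Set where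
    []  : ∀ {u} → Walk u u 0
    _∷_ : ∀ {u y x k m} → w G u y ≡ just k → Walk y x m → Walk u x (k + m)

  -- d_G(u,x) = d : there is a walk of weight d, and none lighter.
  -- (If x is unreachable from u, d_G(u,x) = ∞ and no d satisfies this.)
  IsDist : Fin n → Fin n → ℕ → Set
  IsDist u x d = Walk u x d × (∀ m → Walk u x m → d ≤ m)

  module Clustering (ID : Fin n → ℕ) (r : ℕ) (δ : Fin n → ℕ) where

    DU : Fin n → Fin n → ℕ → Set
    DU u x L = Σ ℕ λ d → IsDist u x d × L ≡ (r ∸ δ u) + d

    IsCenter : Fin n → Fin n → Set
    IsCenter x c =
      Σ ℕ λ L → DU c x L ×
        (∀ u L' → DU u x L' → (L ≤ L') × (L' ≡ L → ID c ≤ ID u))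

    InCluster : Fin n → Fin n → Set
    InCluster v x = IsCenter x v

    -- A tree rooted at v spanning the cluster of v, using only edges of G
    -- with both endpoints in the cluster, given by a parent map; depth is the
    -- weighted distance to the root in the tree (strictly decreasing towards
    -- the root since weights are ≥ 1, so the parent edges form a tree).
    record RootedClusterTree (v : Fin n) (h : ℕ) : Set where
      field
        parent : Fin n → Fin n
        depth  : Fin n → ℕ
        root-depth : depth v ≡ 0
        parent-in  : ∀ x → InCluster v x → ¬ (x ≡ v) → InCluster v (parent x)
        parent-edge : ∀ x → InCluster v x → ¬ (x ≡ v) →
          Σ ℕ λ k → (w G x (parent x) ≡ just k) × (depth x ≡ depth (parent x) + k)
        height : ∀ x → InCluster v x → depth x ≤ h

-- Let v be a centre and write ℓ_u(x) = (r ∸ δ u) + d_G(u,x). If v is the centre of x and y lies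
-- on a shortest v–x path, then for every u the triangle inequality d(u,x) ≤ d(u,y) + d(y,x)
-- turns the optimality of v at x into optimality at y, ties included; so clusters are closed
-- under taking prefixes of shortest paths from their centre. Hence v is in its own cluster, and
-- every other member x has, as parent, the previous vertex on a shortest v–x path, found by
-- comparing the depths d(v,·) (computable because walks of a given weight are decidable, all
-- weights being positive). Depths are at most r since ℓ_v(x) ≤ ℓ_x(x) ≤ r.
module Submission where

open import Defs
open import Data.Nat using (ℕ; zero; suc; _+_; _∸_; _≤_; _<_; z≤n; s≤s; _≤?_; _≟_)
open import Data.Nat.Properties
open import Data.Nat.Induction using (<-rec)
open import Data.Fin using (Fin)
open import Data.Fin.Properties using (any?) renaming (_≟_ to _≟ᶠ_)
open import Data.Maybe using (just; nothing)
open import Data.Product using (Σ; ∃; ∃-syntax; _×_; _,_; proj₁; proj₂)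
open import Data.Sum using (_⊎_; inj₁; inj₂; [_,_]′)
open import Function using (const)
open import Function.Definitions using (Injective)
open import Relation.Binary.PropositionalEquality
open import Relation.Nullary using (¬_; Dec; yes; no; contradiction)
open import Relation.Nullary.Decidable using (map′; _⊎-dec_; _×-dec_)
open import Relation.Unary using (Decidable)

squeeze : ∀ {a b c e} → a + e ≤ b → b ≤ c + e → a ≤ c × (c ≡ a → b ≡ a + e)
squeeze {a} {b} {c} {e} a+e≤b b≤c+e =
  +-cancelʳ-≤ e a c (≤-trans a+e≤b b≤c+e) , λ { refl → ≤-antisym b≤c+e a+e≤b }

Least : (ℕ → Set) → ℕ → Set
Least P k = P k × (∀ j → P j → k ≤ j)

Least-unique : ∀ {P i j} → Least P i → Least P j → i ≡ j
Least-unique (pi , i≤) (pj , j≤) = ≤-antisym (i≤ _ pj) (j≤ _ pi)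

module _ {P : ℕ → Set} (P? : Decidable P) where

  searchBelow : ∀ b → (∃[ k ] k < b × Least P k) ⊎ (∀ j → j < b → ¬ P j)
  searchBelow zero = inj₂ λ _ ()
  searchBelow (suc b) with searchBelow b
  ... | inj₁ (k , k<b , lk) = inj₁ (k , m<n⇒m<1+n k<b , lk)
  ... | inj₂ none with P? b
  ...   | yes pb = inj₁ (b , n<1+n b , pb , λ j pj → ≮⇒≥ λ j<b → none j j<b pj)
  ...   | no ¬pb = inj₂ λ j j<1+b →
            [ none j , (λ { refl → ¬pb }) ]′ (m<1+n⇒m<n∨m≡n j<1+b)

  least : ∀ {m} → P m → ∃ (Least P)
  least {m} pm with searchBelow (suc m)
  ... | inj₁ (k , _ , lk) = k , lk
  ... | inj₂ none = contradiction pm (none m (n<1+n m))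

  minBelow : ℕ → ℕ
  minBelow b = [ proj₁ , const b ]′ (searchBelow b)

  minBelow-least : ∀ {b d} → Least P d → d < b → minBelow b ≡ d
  minBelow-least {b} {d} ld d<b with searchBelow b
  ... | inj₁ (k , _ , lk) = Least-unique lk ld
  ... | inj₂ none = contradiction (proj₁ ld) (none d d<b)

  minBelow-<⇒Least : ∀ {b} → minBelow b < b → Least P (minBelow b)
  minBelow-<⇒Least {b} lt with searchBelow b
  ... | inj₁ (k , _ , lk) = lk
  ... | inj₂ _ = contradiction lt (<-irrefl refl)

witnessOr : ∀ {A : Set} {P : A → Set} → Dec (Σ A P) → A → A
witnessOr (yes (a , _)) _ = a
witnessOr (no _) a = a

witnessOr-satisfies : ∀ {A : Set} {P : A → Set} (d : Dec (Σ A P)) a → Σ A P → P (witnessOr d a)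
witnessOr-satisfies (yes (_ , pa)) _ _ = pa
witnessOr-satisfies (no ∄) _ ∃pa = contradiction ∃pa ∄

module Walks {n W : ℕ} (G : WGraph n W) where

  _++ʷ_ : ∀ {u y x a b} → Walk G u y a → Walk G y x b → Walk G u x (a + b)
  [] ++ʷ q = q
  (_∷_ {k = k} {m = m} e p) ++ʷ q = subst (Walk G _ _) (sym (+-assoc k m _)) (e ∷ (p ++ʷ q))

  edge : ∀ {y x k} → w G y x ≡ just k → Walk G y x k
  edge {k = k} e = subst (Walk G _ _) (+-identityʳ k) (e ∷ [])

  walk-initLast : ∀ {u x m} → Walk G u x m →
    (u ≡ x × m ≡ 0) ⊎ (∃[ y ] ∃[ k ] ∃[ m′ ] Walk G u y m′ × w G y x ≡ just k × m ≡ m′ + k)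
  walk-initLast [] = inj₁ (refl , refl)
  walk-initLast (_∷_ {u = u} {k = k} e p) with walk-initLast p
  ... | inj₁ (refl , refl) = inj₂ (u , k , 0 , [] , e , +-identityʳ k)
  ... | inj₂ (y , k′ , m′ , q , e′ , refl) =
          inj₂ (y , k′ , k + m′ , e ∷ q , e′ , sym (+-assoc k m′ k′))

  FirstStepVia : Fin n → Fin n → Fin n → ℕ → Set
  FirstStepVia y z x m = ∃[ k ] w G y z ≡ just k × ∃[ m′ ] Walk G z x m′ × m ≡ k + m′

  walk-view : ∀ {y x m} → Walk G y x m → (y ≡ x × m ≡ 0) ⊎ ∃[ z ] FirstStepVia y z x m
  walk-view [] = inj₁ (refl , refl)
  walk-view (_∷_ {y = z} {k = k} {m = m′} e p) = inj₂ (z , k , e , m′ , p , refl)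

  walk-unview : ∀ {y x m} → (y ≡ x × m ≡ 0) ⊎ ∃[ z ] FirstStepVia y z x m → Walk G y x m
  walk-unview (inj₁ (refl , refl)) = []
  walk-unview (inj₂ (_ , _ , e , _ , p , refl)) = e ∷ p

  firstStepVia? : ∀ {m x} y z → (∀ {j} → j < m → Dec (Walk G z x j)) → Dec (FirstStepVia y z x m)
  firstStepVia? {m} {x} y z walk<? with w G y z in eq
  ... | nothing = no λ { (_ , () , _) }
  ... | just k with k ≤? m
  ...   | no k≰m = no λ { (_ , refl , m′ , _ , refl) → k≰m (m≤m+n k m′) }
  ...   | yes k≤m =
          map′ (λ p → k , refl , m ∸ k , p , sym (m+[n∸m]≡n k≤m))
               (λ { (_ , refl , m′ , p , refl) → subst (Walk G z x) (sym (m+n∸m≡n k m′)) p })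
               (walk<? (∸-monoʳ-< (proj₁ (weight-range G y z k eq)) k≤m))

  -- Positive weights make the weight of the remaining walk drop after each step.
  walk? : ∀ m y x → Dec (Walk G y x m)
  walk? = <-rec (λ m → ∀ y x → Dec (Walk G y x m)) λ m walk<? y x →
    map′ walk-unview walk-view
      ((y ≟ᶠ x ×-dec m ≟ 0) ⊎-dec any? λ z → firstStepVia? y z (λ j<m → walk<? j<m z x))

  dist : ∀ {u x m} → Walk G u x m → ∃ (IsDist G u x)
  dist {u} {x} = least (λ m → walk? m u x)

  IsDist-refl : ∀ {x} → IsDist G x x 0
  IsDist-refl = [] , λ _ _ → z≤n

  IsDist-prefix : ∀ {u y x a b} → Walk G u y a → Walk G y x b → IsDist G u x (a + b) → IsDist G u y a
  IsDist-prefix {b = b} p q (_ , shortest) =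
    p , λ m p′ → +-cancelʳ-≤ b _ m (shortest (m + b) (p′ ++ʷ q))

module ClusterTree {n W : ℕ} (G : WGraph n W) (ID : Fin n → ℕ) (r : ℕ) (δ : Fin n → ℕ) (v : Fin n) where
  open Walks G
  open Clustering G ID r δ

  offset : Fin n → ℕ
  offset u = r ∸ δ u

  IsCenter-prefix : ∀ {x y a b} → IsCenter x v → IsDist G v x (a + b) →
    IsDist G v y a → Walk G y x b → IsCenter y v
  IsCenter-prefix {x} {y} {a} {b} (_ , (d , isd , refl) , optimal) isd-x isd-y q =
    offset v + a , (a , isd-y , refl) , optimal-y
    where
    level-split : offset v + d ≡ offset v + a + b
    level-split = trans (cong (offset v +_) (Least-unique isd isd-x)) (sym (+-assoc (offset v) a b))

    optimal-y : ∀ u L → DU u y L → (offset v + a ≤ L) × (L ≡ offset v + a → ID v ≤ ID u)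
    optimal-y u _ (d′ , isd′ , refl) with dist (proj₁ isd′ ++ʷ q)
    ... | d″ , isd″ =
      let v≤u , tie = optimal u (offset u + d″) (d″ , isd″ , refl)
          v≤u′ , tie-at-x = squeeze (subst (_≤ offset u + d″) level-split v≤u) via-y
      in v≤u′ , λ eq → tie (trans (tie-at-x eq) (sym level-split))
      where
      via-y : offset u + d″ ≤ offset u + d′ + b
      via-y = ≤-trans (+-monoʳ-≤ (offset u) (proj₂ isd″ _ (proj₁ isd′ ++ʷ q)))
                      (≤-reflexive (sym (+-assoc (offset u) d′ b)))

  -- Defaults to r + 1 when there is no walk of weight ≤ r, so a depth ≤ r is always a distance.
  depth : Fin n → ℕ
  depth x = minBelow (λ m → walk? m v x) (suc r)

  depth-dist : ∀ {x d} → IsDist G v x d → d ≤ r → depth x ≡ d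
  depth-dist isd d≤r = minBelow-least _ isd (s≤s d≤r)

  depth-center : depth v ≡ 0
  depth-center = depth-dist IsDist-refl z≤n

  depth≤r⇒dist : ∀ {x} → depth x ≤ r → IsDist G v x (depth x)
  depth≤r⇒dist depth≤r = minBelow-<⇒Least _ (s≤s depth≤r)

  InCluster-depth : ∀ {x} → InCluster v x → IsDist G v x (depth x) × depth x ≤ r
  InCluster-depth {x} (_ , (d , isd , refl) , optimal) =
    subst (IsDist G v x) (sym depth≡d) isd , subst (_≤ r) (sym depth≡d) d≤r
    where
    open ≤-Reasoning
    d≤r : d ≤ r
    d≤r = begin
      d              ≤⟨ m≤n+m d (offset v) ⟩
      offset v + d   ≤⟨ proj₁ (optimal x (offset x + 0) (0 , IsDist-refl , refl)) ⟩
      offset x + 0   ≡⟨ +-identityʳ (offset x) ⟩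
      r ∸ δ x        ≤⟨ m∸n≤m r (δ x) ⟩
      r              ∎
    depth≡d = depth-dist isd d≤r

  center-in-cluster : ∀ {x} → InCluster v x → InCluster v v
  center-in-cluster c =
    let isd = proj₁ (InCluster-depth c) in IsCenter-prefix c isd IsDist-refl (proj₁ isd)

  ParentEdge : Fin n → Fin n → Set
  ParentEdge x y = ∃[ k ] w G x y ≡ just k × depth x ≡ depth y + k

  parentEdge? : ∀ x y → Dec (ParentEdge x y)
  parentEdge? x y with w G x y
  ... | nothing = no λ { (_ , () , _) }
  ... | just k = map′ (λ eq → k , refl , eq) (λ { (_ , refl , eq) → eq }) (depth x ≟ depth y + k)

  ParentEdge-exists : ∀ {x} → InCluster v x → ¬ x ≡ v → ∃ (ParentEdge x)
  ParentEdge-exists {x} c x≢v with InCluster-depth c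
  ... | isd , depth≤r with walk-initLast (proj₁ isd)
  ... | inj₁ (v≡x , _) = contradiction (sym v≡x) x≢v
  ... | inj₂ (y , k , m , p , e , depth≡) =
          y , k , trans (symmetric G x y) e , trans depth≡ (cong (_+ k) (sym depth≡m))
    where
    depth≡m : depth y ≡ m
    depth≡m = depth-dist (IsDist-prefix p (edge e) (subst (IsDist G v x) depth≡ isd))
                         (≤-trans (m≤m+n m k) (subst (_≤ r) depth≡ depth≤r))

  parent : Fin n → Fin n
  parent x = witnessOr (any? (parentEdge? x)) x

  parent-edge : ∀ {x} → InCluster v x → ¬ x ≡ v → ParentEdge x (parent x)
  parent-edge {x} c x≢v = witnessOr-satisfies (any? (parentEdge? x)) x (ParentEdge-exists c x≢v)

  ParentEdge⇒InCluster : ∀ {x y} → InCluster v x → ParentEdge x y → InCluster v y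
  ParentEdge⇒InCluster {x} {y} c (k , e , depth≡) =
    IsCenter-prefix c isd-x (depth≤r⇒dist depth-y≤r) (edge (trans (symmetric G y x) e))
    where
    isd-x : IsDist G v x (depth y + k)
    isd-x = subst (IsDist G v x) depth≡ (proj₁ (InCluster-depth c))
    depth-y≤r : depth y ≤ r
    depth-y≤r = ≤-trans (m≤m+n (depth y) k) (subst (_≤ r) depth≡ (proj₂ (InCluster-depth c)))

  parent-in-cluster : ∀ {x} → InCluster v x → ¬ x ≡ v → InCluster v (parent x)
  parent-in-cluster c x≢v = ParentEdge⇒InCluster c (parent-edge c x≢v)

lemma7 : (n W : ℕ) (G : WGraph n W) (ID : Fin n → ℕ) → Injective _≡_ _≡_ ID →
         (r : ℕ) (δ : Fin n → ℕ) → (∀ v → δ v ≤ r) →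
         (v : Fin n) → Σ (Fin n) (λ x → Clustering.IsCenter G ID r δ x v) →
         Clustering.InCluster G ID r δ v v × Clustering.RootedClusterTree G ID r δ v r
lemma7 n W G ID _ r δ _ v (_ , c) = center-in-cluster c , record
  { parent      = parent
  ; depth       = depth
  ; root-depth  = depth-center
  ; parent-in   = λ _ → parent-in-cluster
  ; parent-edge = λ _ → parent-edge
  ; height      = λ _ c′ → proj₂ (InCluster-depth c′)
  }
  where open ClusterTree G ID r δ v
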